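{- Let $n\geq1$. Then 1. $a_{1,2}(4n)=b_{1,2}(4n)$; 2. $a_{2,1}(4n)=c_{1,1}(4n)$; 3. $a_{2,2}(4n)=a_{1,2}(4n+1)=c_{1,2}(4n)=b_{2,2}(4n)$; 4. $a_{1,1}(4n+1)=b_{1,1}(4n+1)=b_{2,1}(4n)$; 5. $a_{2,1}(4n+1)=a_{1,1}(4n+2)=c_{1,1}(4n+1)=b_{2,1}(4n+1)$; 6. $a_{2,2}(4n+1)=c_{1,2}(4n+1)=c_{2,2}(4n)$; 7. $a_{1,2}(4n+2)=b_{1,2}(4n+2)=b_{2,2}(4n+1)$; 8. $a_{2,1}(4n+2)=c_{1,1}(4n+2)=c_{2,1}(4n+1)$; 9. $a_{2,2}(4n+2)=a_{1,2}(4n+3)=c_{1,2}(4n+2)=b_{2,2}(4n+2)$; 10. $a_{1,1}(4n+3)=b_{1,1}(4n+3)=b_{2,1}(4n+2)$; 11. $a_{2,1}(4n+3)=c_{1,1}(4n+3)=b_{2,1}(4n+3)$; 12. $a_{2,2}(4n+3)=c_{1,2}(4n+3)=c_{2,2}(4n+2)$.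
   Context: Let $\mathcal{A}=\{\mathtt{A},\dots,\mathtt{P}\}$. The substitution $\mu$ maps each letter to a $2\times2$ block over $\mathcal{A}$ (written (first row / second row)): $\mathtt{A}\mapsto(\mathtt{AF}/\mathtt{GC})$, $\mathtt{B}\mapsto(\mathtt{AF}/\mathtt{HD})$, $\mathtt{C}\mapsto(\mathtt{BE}/\mathtt{GC})$, $\mathtt{D}\mapsto(\mathtt{BE}/\mathtt{HD})$, $\mathtt{E}\mapsto(\mathtt{AN}/\mathtt{GK})$, $\mathtt{F}\mapsto(\mathtt{AN}/\mathtt{HL})$, $\mathtt{G}\mapsto(\mathtt{BM}/\mathtt{GK})$, $\mathtt{H}\mapsto(\mathtt{BM}/\mathtt{HL})$, $\mathtt{I}\mapsto(\mathtt{IF}/\mathtt{OC})$, $\mathtt{J}\mapsto(\mathtt{IF}/\mathtt{PD})$, $\mathtt{K}\mapsto(\mathtt{JE}/\mathtt{OC})$, $\mathtt{L}\mapsto(\mathtt{JE}/\mathtt{PD})$, $\mathtt{M}\mapsto(\mathtt{IN}/\mathtt{OK})$, $\mathtt{N}\mapsto(\mathtt{IN}/\mathtt{PL})$, $\mathtt{O}\mapsto(\mathtt{JM}/\mathtt{OK})$, $\mathtt{P}\mapsto(\mathtt{JM}/\mathtt{PL})$. For a matrix $X$ over $\mathcal{A}$, $\mu(X)$ replaces each entry by its $2\times2$ block; $\mu^0=\mathrm{id}$, $\mu^k=\mu^{k-1}\circ\mu$; $T_k:=\mu^k(\mathtt{N})$. For a matrix $X$, $X[r,c,m\times n]$ is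 its $m\times n$ contiguous submatrix with upper-left corner at row $r$, column $c$; $P(X,m\times n)$ is the set of all its $m\times n$ contiguous submatrices; $P(T,m\times n):=\bigcup_{k\ge0}P(T_k,m\times n)$. For $i,j\in\{1,2\}$, $P_{i,j}(T,m\times n):=\{\mu(x)[i,j,m\times n]: x\in P(T,m\times n)\}$. Define $a_{i,j}(n):=|P_{i,j}(T,n\times n)|$, $b_{i,j}(n):=|P_{i,j}(T,n\times(n+1))|$, $c_{i,j}(n):=|P_{i,j}(T,(n+1)\times n)|$. -}

module Defs where

open import Data.Nat using (ℕ; zero; suc; _+_; _*_; _∸_; _^_; _≤_)
open import Data.List using (List; []; _∷_; map; take; drop; concatMap; length)
open import Data.List.Membership.Propositional using (_∈_)
open import Data.List.Relation.Unary.Unique.Propositional using (Unique)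
open import Data.Product using (Σ; _×_; _,_; ∃)
open import Relation.Binary.PropositionalEquality using (_≡_)
open import Function.Bundles using (_⇔_)

data Letter : Set where
  A B C D E F G H I J K L M N O P : Letter

-- A matrix over the alphabet, stored as a list of rows.
Mat : Set
Mat = List (List Letter)

record Block : Set where
  constructor blk
  field
    tl tr bl br : Letter

block : Letter → Block
block A = blk A F G C
block B = blk A F H D
block C = blk B E G C
block D = blk B E H D
block E = blk A N G K
block F = blk A N H L
block G = blk B M G K
block H = blk B M H L
block I = blk I F O C
block J = blk I F P D
block K = blk J E O C
block L = blk J E P D
block M = blk I N O K
block N = blk I N P L
block O = blk J M O K
block P = blk J M P L

topRow : List Letter → List Letter
topRow = concatMap (λ a → Block.tl (block a) ∷ Block.tr (block a) ∷ [])

botRow : List Letter → List Letter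
botRow = concatMap (λ a → Block.bl (block a) ∷ Block.br (block a) ∷ [])

μ : Mat → Mat
μ = concatMap (λ row → topRow row ∷ botRow row ∷ [])

T : ℕ → Mat
T zero    = (N ∷ []) ∷ []
T (suc k) = μ (T k)

-- X[r,c,m×n]: contiguous m×n submatrix with upper-left corner at
-- row r, column c (1-based, as in the paper).
sub : (r c m n : ℕ) → Mat → Mat
sub r c m n X = map (λ row → take n (drop (c ∸ 1) row)) (take m (drop (r ∸ 1) X))

InPT : (m n : ℕ) → Mat → Set
InPT m n x = Σ ℕ λ k → Σ ℕ λ r → Σ ℕ λ c →
  (1 ≤ r) × (1 ≤ c) × (r + m ≤ 2 ^ k + 1) × (c + n ≤ 2 ^ k + 1) ×
  (x ≡ sub r c m n (T k))

InPij : (i j m n : ℕ) → Mat → Set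
InPij i j m n y = Σ Mat λ x → InPT m n x × (y ≡ sub i j m n (μ x))

Aset Bset Cset : (i j n : ℕ) → Mat → Set
Aset i j n = InPij i j n n
Bset i j n = InPij i j n (suc n)
Cset i j n = InPij i j (suc n) n

HasCard : (Mat → Set) → ℕ → Set
HasCard S k = Σ (List Mat) λ xs → (length xs ≡ k) × Unique xs × (∀ y → S y ⇔ y ∈ xs)

SameCard : (Mat → Set) → (Mat → Set) → Set
SameCard S₁ S₂ = Σ ℕ λ k → HasCard S₁ k × HasCard S₂ k

{-# OPTIONS --safe #-}
module Submission where

-- The matrices T k are the top-right corners of a fixed point τ of μ, a quarter-plane
-- extending down and to the left; its rows are indexed from the top and its columns from
-- the right, both from 0.  Every factor of T is a window of τ, and P_{i,j}(T, m×n) consists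
-- exactly of the m×n windows whose top row has parity i − 1 and whose rightmost column has
-- parity n − j + 1.  The explicitly computed list of 2×2 factors of τ, closed under μ, shows
-- that every window also occurs at one of finitely many positions away from the right edge
-- of τ; this gives the inclusion ⊇ and the finiteness of these parity classes.
-- Within a parity class, deleting the top row of the windows whose top row is even, or the
-- right column of the windows whose right column is even, is a bijection onto the class of
-- opposite parity, because in τ a letter in an even row is determined by the parity of its
-- column and the two letters below it, and symmetrically for columns.  Hence for m, n ≥ 2
-- the size of P_{i,j}(T, m×n) depends only on (m + [i = 2], n + [n − j + 1 odd]), and each
-- of the twelve claims compares two sets for which this pair agrees.

open import Data.Fin using (Fin; #_)
open import Data.Fin.Properties using (inj⇒≟)
open import Data.List
  using (List; []; _∷_; map; take; drop; concatMap; lookup; length; filter; deduplicate;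
         upTo; applyUpTo; applyDownFrom; cartesianProduct; cartesianProductWith)
open import Data.List.Membership.Propositional using (_∈_)
open import Data.List.Membership.Propositional.Properties
  using (∈-map⁺; ∈-map⁻; ∈-upTo⁺; ∈-cartesianProduct⁺; ∈-cartesianProductWith⁺;
         ∈-filter⁺; ∈-filter⁻; deduplicate-∈⇔)
open import Data.List.Membership.Propositional.Properties.WithK using (unique∧set⇒bag)
import Data.List.Membership.DecPropositional as DecMembership
open import Data.List.Properties using (∷-injective; map-applyUpTo; length-map; ≡-dec)
open import Data.List.Relation.Binary.BagAndSetEquality using (∼bag⇒↭)
open import Data.List.Relation.Binary.Permutation.Propositional.Properties using (↭-length)
open import Data.List.Relation.Unary.All as All using (All; all?)
import Data.List.Relation.Unary.All.Properties as All
open import Data.List.Relation.Unary.AllPairs using ([]; _∷_)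
open import Data.List.Relation.Unary.Any using (here; there)
open import Data.List.Relation.Unary.Unique.Propositional using (Unique)
open import Data.List.Relation.Unary.Unique.DecPropositional.Properties using (deduplicate-!)
open import Data.Nat
  using (ℕ; zero; suc; pred; _+_; _*_; _∸_; _^_; _/_; _%_; _≤_; _<_; _≤′_; ≤′-refl; ≤′-step;
         z≤n; s≤s; s≤s⁻¹; ⌊_/2⌋; parity; NonZero)
open import Data.Nat.DivMod using (m≡m%n+[m/n]*n; m%n<n)
open import Data.Nat.Properties hiding (_≟_)
open import Algebra.Properties.CommutativeSemigroup +-commutativeSemigroup
  using (x∙yz≈y∙xz; xy∙z≈y∙xz)
open import Data.Parity.Base as ℙ using (Parity; 0ℙ; 1ℙ; _⁻¹)
open import Data.Parity.Properties using (suc-homo-⁻¹; +-homo-+; *-homo-*) renaming (_≟_ to _≟ₚ_)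
open import Data.Product using (∃; ∃₂; _×_; _,_; proj₁; proj₂; uncurry)
import Data.Product.Properties as ×
open import Data.Sum using (inj₁; inj₂)
open import Function using (_∘_)
open import Function.Bundles using (_⇔_; mk⇔; mk↣; Equivalence)
import Function.Properties.Equivalence as ⇔
open import Relation.Binary.Definitions using (DecidableEquality)
open import Relation.Binary.PropositionalEquality
  using (_≡_; refl; sym; trans; cong; cong₂; subst; subst₂; setoid; module ≡-Reasoning)
open import Relation.Nullary using (Dec)
open import Relation.Nullary.Decidable using (from-yes; _→-dec_; _×-dec_)
open import Relation.Unary using (Decidable)

open import Defs

double : ℕ → ℕ
double zero    = zero
double (suc n) = suc (suc (double n))

bit : Parity → ℕ
bit 0ℙ = 0
bit 1ℙ = 1

double≡+ : ∀ n → double n ≡ n + n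
double≡+ zero    = refl
double≡+ (suc n) = cong suc (trans (cong suc (double≡+ n)) (sym (+-suc n n)))

⌊double/2⌋ : ∀ x → ⌊ double x /2⌋ ≡ x
⌊double/2⌋ zero    = refl
⌊double/2⌋ (suc x) = cong suc (⌊double/2⌋ x)

⌊suc-double/2⌋ : ∀ x → ⌊ suc (double x) /2⌋ ≡ x
⌊suc-double/2⌋ zero    = refl
⌊suc-double/2⌋ (suc x) = cong suc (⌊suc-double/2⌋ x)

⌊+double/2⌋ : ∀ n x → ⌊ n + double x /2⌋ ≡ ⌊ n /2⌋ + x
⌊+double/2⌋ zero          x = ⌊double/2⌋ x
⌊+double/2⌋ (suc zero)    x = ⌊suc-double/2⌋ x
⌊+double/2⌋ (suc (suc n)) x = cong suc (⌊+double/2⌋ n x)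

⌊bit+double/2⌋ : ∀ p x → ⌊ bit p + double x /2⌋ ≡ x
⌊bit+double/2⌋ 0ℙ = ⌊double/2⌋
⌊bit+double/2⌋ 1ℙ = ⌊suc-double/2⌋

parity-double : ∀ x → parity (double x) ≡ 0ℙ
parity-double zero    = refl
parity-double (suc x) = parity-double x

parity-suc-double : ∀ x → parity (suc (double x)) ≡ 1ℙ
parity-suc-double zero    = refl
parity-suc-double (suc x) = parity-suc-double x

parity-+double : ∀ n x → parity (n + double x) ≡ parity n
parity-+double zero          x = parity-double x
parity-+double (suc zero)    x = parity-suc-double x
parity-+double (suc (suc n)) x = parity-+double n x

parity-bit+double : ∀ p x → parity (bit p + double x) ≡ p
parity-bit+double 0ℙ = parity-double
parity-bit+double 1ℙ = parity-suc-double

bit+double-⌊/2⌋ : ∀ n → bit (parity n) + double ⌊ n /2⌋ ≡ n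
bit+double-⌊/2⌋ zero          = refl
bit+double-⌊/2⌋ (suc zero)    = refl
bit+double-⌊/2⌋ (suc (suc n)) = begin
  bit (parity n) + suc (suc (double ⌊ n /2⌋))    ≡⟨ +-suc (bit (parity n)) _ ⟩
  suc (bit (parity n) + suc (double ⌊ n /2⌋))    ≡⟨ cong suc (+-suc (bit (parity n)) _) ⟩
  suc (suc (bit (parity n) + double ⌊ n /2⌋))    ≡⟨ cong (suc ∘ suc) (bit+double-⌊/2⌋ n) ⟩
  suc (suc n)                                    ∎
  where open ≡-Reasoning

parity-split : ∀ {p} d → parity d ≡ p → ∃ λ b → d ≡ bit p + double b
parity-split d refl = ⌊ d /2⌋ , sym (bit+double-⌊/2⌋ d)

parity-suc : ∀ n → parity (suc n) ≡ parity n ⁻¹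
parity-suc zero          = refl
parity-suc (suc zero)    = refl
parity-suc (suc (suc n)) = parity-suc n

odd⇒suc : ∀ r → parity r ≡ 1ℙ → ∃ λ r′ → r ≡ suc r′ × parity r′ ≡ 0ℙ
odd⇒suc zero    ()
odd⇒suc (suc r) r-odd = r , refl , trans (sym (suc-homo-⁻¹ r)) (cong _⁻¹ r-odd)

parity-+ : ∀ {q} b d → parity d ≡ q → parity (b + d) ≡ parity b ℙ.+ q
parity-+ b d refl = +-homo-+ b d

same-parity-split : ∀ {e} x → e ≤ x → parity x ≡ parity e → ∃ λ y → x ≡ e + double y
same-parity-split {zero}  x       _         x-even = parity-split x x-even
same-parity-split {suc e} (suc x) (s≤s e≤x) x~e    =
  let y , x≡ = same-parity-split x e≤x (trans (sym (suc-homo-⁻¹ x)) (trans (cong _⁻¹ x~e) (suc-homo-⁻¹ e)))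
  in y , cong suc x≡

≤-by-parity : ∀ {i} x → i ≤ 1 → parity x ≡ parity i → i ≤ x
≤-by-parity x       z≤n       _  = z≤n
≤-by-parity (suc x) (s≤s z≤n) _  = s≤s z≤n
≤-by-parity zero    (s≤s z≤n) ()

⌊/2⌋<-double : ∀ {n x} → n < double x → ⌊ n /2⌋ < x
⌊/2⌋<-double {n}           {zero}  ()
⌊/2⌋<-double {zero}        {suc x} _                = s≤s z≤n
⌊/2⌋<-double {suc zero}    {suc x} _                = s≤s z≤n
⌊/2⌋<-double {suc (suc n)} {suc x} (s≤s (s≤s n<2x)) = s≤s (⌊/2⌋<-double n<2x)

2^-suc : ∀ k → 2 ^ suc k ≡ double (2 ^ k)
2^-suc k = trans (cong (2 ^ k +_) (+-identityʳ (2 ^ k))) (sym (double≡+ (2 ^ k)))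

⌊/2⌋<2^ : ∀ {n} k → n < 2 ^ suc k → ⌊ n /2⌋ < 2 ^ k
⌊/2⌋<2^ k n<2^1+k = ⌊/2⌋<-double (subst (_ <_) (2^-suc k) n<2^1+k)

n<2^n : ∀ n → n < 2 ^ n
n<2^n zero    = s≤s z≤n
n<2^n (suc n) = ≤-trans (s≤s (n<2^n n)) (≤-trans (≤-reflexive (+-comm 1 (2 ^ n)))
  (+-monoʳ-≤ (2 ^ n) (≤-trans (m^n>0 2 n) (m≤m+n (2 ^ n) 0))))

<2^ : ∀ {m k} → m ≤ k → m < 2 ^ k
<2^ {m} m≤k = <-≤-trans (n<2^n m) (^-monoʳ-≤ 2 m≤k)

height≤2^ : ∀ h w → h ≤ 2 ^ suc (h + w)
height≤2^ h w = <⇒≤ (<2^ (m≤n⇒m≤1+n (m≤m+n h w)))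

width≤2^ : ∀ h w → w ≤ 2 ^ suc (h + w)
width≤2^ h w = <⇒≤ (<2^ (m≤n⇒m≤1+n (m≤n+m w h)))

double^ : ℕ → ℕ → ℕ
double^ zero    a = a
double^ (suc l) a = double (double^ l a)

double^≡*2^ : ∀ l a → double^ l a ≡ a * 2 ^ l
double^≡*2^ zero    a = sym (*-identityʳ a)
double^≡*2^ (suc l) a = begin
  double (double^ l a)     ≡⟨ cong double (double^≡*2^ l a) ⟩
  double (a * 2 ^ l)       ≡⟨ double≡+ (a * 2 ^ l) ⟩
  a * 2 ^ l + a * 2 ^ l    ≡⟨ sym (*-distribˡ-+ a (2 ^ l) (2 ^ l)) ⟩
  a * (2 ^ l + 2 ^ l)      ≡⟨ cong (a *_) (trans (sym (double≡+ (2 ^ l))) (sym (2^-suc l))) ⟩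
  a * 2 ^ suc l            ∎
  where open ≡-Reasoning

divMod-2^ : ∀ l n → ∃₂ λ s a → s < 2 ^ l × n ≡ s + double^ l a
divMod-2^ l n = n % 2 ^ l , n / 2 ^ l , m%n<n n (2 ^ l) ,
  trans (m≡m%n+[m/n]*n n (2 ^ l)) (cong (n % 2 ^ l +_) (sym (double^≡*2^ l (n / 2 ^ l))))
  where
  instance
    2^l≢0 : NonZero (2 ^ l)
    2^l≢0 = m^n≢0 2 l

double-split : ∀ {i m} → i ≤ m → double m ≡ i + (m + (m ∸ i))
double-split {i} {m} i≤m = begin
  double m             ≡⟨ double≡+ m ⟩
  m + m                ≡⟨ cong (m +_) (sym (m+[n∸m]≡n i≤m)) ⟩
  m + (i + (m ∸ i))    ≡⟨ x∙yz≈y∙xz m i (m ∸ i) ⟩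
  i + (m + (m ∸ i))    ∎
  where open ≡-Reasoning

code : Letter → Fin 16
code A = # 0
code B = # 1
code C = # 2
code D = # 3
code E = # 4
code F = # 5
code G = # 6
code H = # 7
code I = # 8
code J = # 9
code K = # 10
code L = # 11
code M = # 12
code N = # 13
code O = # 14
code P = # 15

letters : List Letter
letters = A ∷ B ∷ C ∷ D ∷ E ∷ F ∷ G ∷ H ∷ I ∷ J ∷ K ∷ L ∷ M ∷ N ∷ O ∷ P ∷ []

lookup-code : ∀ x → lookup letters (code x) ≡ x
lookup-code A = refl
lookup-code B = refl
lookup-code C = refl
lookup-code D = refl
lookup-code E = refl
lookup-code F = refl
lookup-code G = refl
lookup-code H = refl
lookup-code I = refl
lookup-code J = refl
lookup-code K = refl
lookup-code L = refl
lookup-code M = refl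
lookup-code N = refl
lookup-code O = refl
lookup-code P = refl

_≟_ : DecidableEquality Letter
_≟_ = inj⇒≟ {S = setoid Letter} (mk↣ {to = code} λ {x} {y} eq →
  trans (sym (lookup-code x)) (trans (cong (lookup letters) eq) (lookup-code y)))

_≟ₘ_ : DecidableEquality Mat
_≟ₘ_ = ≡-dec (≡-dec _≟_)

HasCard-cover : ∀ {S} ys → (∀ y → S y ⇔ y ∈ ys) → HasCard S (length (deduplicate _≟ₘ_ ys))
HasCard-cover ys S⇔ys = deduplicate _≟ₘ_ ys , refl , deduplicate-! _≟ₘ_ ys ,
                        λ y → ⇔.trans (S⇔ys y) (deduplicate-∈⇔ _≟ₘ_)

HasCard-unique : ∀ {S k k′} → HasCard S k → HasCard S k′ → k ≡ k′
HasCard-unique (xs , refl , xs! , S⇔xs) (ys , refl , ys! , S⇔ys) =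
  ↭-length (∼bag⇒↭ (unique∧set⇒bag xs! ys! λ {z} → ⇔.trans (⇔.sym (S⇔xs z)) (S⇔ys z)))

HasCard-resp-⇔ : ∀ {S S′ k} → (∀ y → S y ⇔ S′ y) → HasCard S k → HasCard S′ k
HasCard-resp-⇔ S⇔S′ (xs , len , xs! , S⇔xs) = xs , len , xs! , λ y → ⇔.trans (⇔.sym (S⇔S′ y)) (S⇔xs y)

record Bijective (f : Mat → Mat) (S S′ : Mat → Set) : Set where
  field
    maps-to    : ∀ {x} → S x → S′ (f x)
    injective  : ∀ {x y} → S x → S y → f x ≡ f y → x ≡ y
    surjective : ∀ {y} → S′ y → ∃ λ x → S x × f x ≡ y

Unique-map⁺ : ∀ (f : Mat → Mat) {xs} → (∀ {x y} → x ∈ xs → y ∈ xs → f x ≡ f y → x ≡ y) →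
              Unique xs → Unique (map f xs)
Unique-map⁺ f         inj []         = []
Unique-map⁺ f {x ∷ _} inj (x∉ ∷ xs!) =
  All.map⁺ (All.tabulate λ y∈ fx≡fy → All.lookup x∉ y∈ (inj (here refl) (there y∈) fx≡fy))
  ∷ Unique-map⁺ f (λ x∈ y∈ → inj (there x∈) (there y∈)) xs!

HasCard-Bijective : ∀ {f S S′ k} → Bijective f S S′ → HasCard S k → HasCard S′ k
HasCard-Bijective {f} {S} {S′} bij (xs , refl , xs! , S⇔xs) =
  map f xs , length-map f xs ,
  Unique-map⁺ f (λ x∈ y∈ → injective (from (S⇔xs _) x∈) (from (S⇔xs _) y∈)) xs! ,
  λ y → mk⇔ onto into
  where
  open Bijective bij
  open Equivalence using (to; from)
  onto : ∀ {y} → S′ y → y ∈ map f xs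
  onto S′y = let x , Sx , fx≡y = surjective S′y in subst (_∈ map f xs) fx≡y (∈-map⁺ f (to (S⇔xs x) Sx))
  into : ∀ {y} → y ∈ map f xs → S′ y
  into y∈ = let x , x∈ , y≡fx = ∈-map⁻ f y∈ in subst S′ (sym y≡fx) (maps-to (from (S⇔xs x) x∈))

SameCard-refl : ∀ {S} → ∃ (HasCard S) → SameCard S S
SameCard-refl (k , card) = k , card , card

SameCard-sym : ∀ {S S′} → SameCard S S′ → SameCard S′ S
SameCard-sym (k , card , card′) = k , card′ , card

SameCard-trans : ∀ {S₁ S₂ S₃} → SameCard S₁ S₂ → SameCard S₂ S₃ → SameCard S₁ S₃
SameCard-trans (k , card₁ , card₂) (k′ , card₂′ , card₃) =
  k , card₁ , subst (HasCard _) (sym (HasCard-unique card₂ card₂′)) card₃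

SameCard-resp-⇔ : ∀ {S S′ S″} → (∀ y → S y ⇔ S′ y) → SameCard S′ S″ → SameCard S S″
SameCard-resp-⇔ S⇔S′ (k , card′ , card″) = k , HasCard-resp-⇔ (λ y → ⇔.sym (S⇔S′ y)) card′ , card″

Bijective⇒SameCard : ∀ {f S S′} → Bijective f S S′ → ∃ (HasCard S) → SameCard S S′
Bijective⇒SameCard bij (k , card) = k , card , HasCard-Bijective bij card

-- child x p q is the letter of μ(x) in the row of parity p and the column of parity q; as
-- columns are counted from the right, column parity 0ℙ is the right column of the block.
child : Letter → Parity → Parity → Letter
child x 0ℙ 0ℙ = Block.tr (block x)
child x 0ℙ 1ℙ = Block.tl (block x)
child x 1ℙ 0ℙ = Block.br (block x)
child x 1ℙ 1ℙ = Block.bl (block x)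

grid : (ℕ → ℕ → Letter) → ℕ → ℕ → Mat
grid f h w = applyUpTo (λ a → applyDownFrom (f a) w) h

applyUpTo-cong : ∀ {A : Set} {u v : ℕ → A} m → (∀ a → u a ≡ v a) → applyUpTo u m ≡ applyUpTo v m
applyUpTo-cong zero    eq = refl
applyUpTo-cong (suc m) eq = cong₂ _∷_ (eq 0) (applyUpTo-cong m (eq ∘ suc))

applyDownFrom-cong : ∀ {A : Set} {u v : ℕ → A} w → (∀ {b} → b < w → u b ≡ v b) →
                     applyDownFrom u w ≡ applyDownFrom v w
applyDownFrom-cong zero    eq = refl
applyDownFrom-cong (suc w) eq = cong₂ _∷_ (eq ≤-refl) (applyDownFrom-cong w (eq ∘ m≤n⇒m≤1+n))

applyDownFrom-injective : ∀ {A : Set} {u v : ℕ → A} w → applyDownFrom u w ≡ applyDownFrom v w →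
                          ∀ {b} → b < w → u b ≡ v b
applyDownFrom-injective (suc w) eq {b} b<1+w with ∷-injective eq | m≤n⇒m<n∨m≡n (s≤s⁻¹ b<1+w)
... | _   , eq′ | inj₁ b<w  = applyDownFrom-injective w eq′ b<w
... | u≡v , _   | inj₂ refl = u≡v

drop-applyUpTo : ∀ {A : Set} (u : ℕ → A) r h → drop r (applyUpTo u (r + h)) ≡ applyUpTo (λ a → u (r + a)) h
drop-applyUpTo u zero    h = refl
drop-applyUpTo u (suc r) h = drop-applyUpTo (u ∘ suc) r h

take-applyUpTo : ∀ {A : Set} (u : ℕ → A) m e → take m (applyUpTo u (m + e)) ≡ applyUpTo u m
take-applyUpTo u zero    e = refl
take-applyUpTo u (suc m) e = cong (u 0 ∷_) (take-applyUpTo (u ∘ suc) m e)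

drop-applyDownFrom : ∀ {A : Set} (u : ℕ → A) c x → drop c (applyDownFrom u (c + x)) ≡ applyDownFrom u x
drop-applyDownFrom u zero    x = refl
drop-applyDownFrom u (suc c) x = drop-applyDownFrom u c x

take-applyDownFrom : ∀ {A : Set} (u : ℕ → A) n e →
                     take n (applyDownFrom u (n + e)) ≡ applyDownFrom (λ b → u (b + e)) n
take-applyDownFrom u zero    e = refl
take-applyDownFrom u (suc n) e = cong (u (n + e) ∷_) (take-applyDownFrom u n e)

take-applyDownFrom-suc : ∀ {A : Set} (u : ℕ → A) w →
                         take w (applyDownFrom u (suc w)) ≡ applyDownFrom (u ∘ suc) w
take-applyDownFrom-suc u zero    = refl
take-applyDownFrom-suc u (suc w) = cong (u (suc w) ∷_) (take-applyDownFrom-suc u w)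

grid-cong : ∀ {f g} h w → (∀ {a b} → a < h → b < w → f a b ≡ g a b) → grid f h w ≡ grid g h w
grid-cong zero    w eq = refl
grid-cong (suc h) w eq = cong₂ _∷_ (applyDownFrom-cong w (eq (s≤s z≤n))) (grid-cong h w (eq ∘ s≤s))

grid-injective : ∀ {f g} h w → grid f h w ≡ grid g h w → ∀ {a b} → a < h → b < w → f a b ≡ g a b
grid-injective (suc h) w eq {zero}  _         = applyDownFrom-injective w (proj₁ (∷-injective eq))
grid-injective (suc h) w eq {suc a} (s≤s a<h) = grid-injective h w (proj₂ (∷-injective eq)) a<h

sub-grid : ∀ f r c m n e₁ e₂ →
  sub (suc r) (suc c) m n (grid f (r + (m + e₁)) (c + (n + e₂))) ≡ grid (λ a b → f (r + a) (b + e₂)) m n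
sub-grid f r c m n e₁ e₂ = begin
  map crop (take m (drop r (applyUpTo row (r + (m + e₁)))))
    ≡⟨ cong (map crop ∘ take m) (drop-applyUpTo row r (m + e₁)) ⟩
  map crop (take m (applyUpTo (λ a → row (r + a)) (m + e₁)))
    ≡⟨ cong (map crop) (take-applyUpTo _ m e₁) ⟩
  map crop (applyUpTo (λ a → row (r + a)) m)
    ≡⟨ map-applyUpTo _ crop m ⟩
  applyUpTo (λ a → crop (row (r + a))) m
    ≡⟨ applyUpTo-cong m (λ a → crop-row (f (r + a))) ⟩
  grid (λ a b → f (r + a) (b + e₂)) m n
    ∎
  where
  open ≡-Reasoning
  row : ℕ → List Letter
  row a = applyDownFrom (f a) (c + (n + e₂))
  crop : List Letter → List Letter
  crop xs = take n (drop c xs)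
  crop-row : ∀ u → crop (applyDownFrom u (c + (n + e₂))) ≡ applyDownFrom (λ b → u (b + e₂)) n
  crop-row u = trans (cong (take n) (drop-applyDownFrom u c (n + e₂))) (take-applyDownFrom u n e₂)

-- blockRow 0ℙ and blockRow 1ℙ are topRow and botRow.
blockRow : Parity → List Letter → List Letter
blockRow p = concatMap (λ x → child x p 1ℙ ∷ child x p 0ℙ ∷ [])

blockRow-applyDownFrom : ∀ p u w →
  blockRow p (applyDownFrom u w) ≡ applyDownFrom (λ b → child (u ⌊ b /2⌋) p (parity b)) (double w)
blockRow-applyDownFrom p u zero    = refl
blockRow-applyDownFrom p u (suc w) =
  cong₂ _∷_ (entry 1ℙ) (cong₂ _∷_ (entry 0ℙ) (blockRow-applyDownFrom p u w))
  where
  entry : ∀ q → child (u w) p q ≡ child (u ⌊ bit q + double w /2⌋) p (parity (bit q + double w))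
  entry q = sym (cong₂ (λ b q′ → child (u b) p q′) (⌊bit+double/2⌋ q w) (parity-bit+double q w))

μ-grid : ∀ f h w →
  μ (grid f h w) ≡ grid (λ a b → child (f ⌊ a /2⌋ ⌊ b /2⌋) (parity a) (parity b)) (double h) (double w)
μ-grid f zero    w = refl
μ-grid f (suc h) w = cong₂ _∷_ (blockRow-applyDownFrom 0ℙ (f 0) w)
                       (cong₂ _∷_ (blockRow-applyDownFrom 1ℙ (f 0) w) (μ-grid (f ∘ suc) h w))

-- The fixed point of μ and its windows

letterAt : ℕ → ℕ → ℕ → Letter
letterAt zero    r d = N
letterAt (suc k) r d = child (letterAt k ⌊ r /2⌋ ⌊ d /2⌋) (parity r) (parity d)

T≡grid : ∀ k → T k ≡ grid (letterAt k) (2 ^ k) (2 ^ k)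
T≡grid zero    = refl
T≡grid (suc k) = begin
  μ (T k)                                                    ≡⟨ cong μ (T≡grid k) ⟩
  μ (grid (letterAt k) (2 ^ k) (2 ^ k))                      ≡⟨ μ-grid (letterAt k) (2 ^ k) (2 ^ k) ⟩
  grid (letterAt (suc k)) (double (2 ^ k)) (double (2 ^ k))  ≡⟨ cong (λ n → grid (letterAt (suc k)) n n)
                                                                     (sym (2^-suc k)) ⟩
  grid (letterAt (suc k)) (2 ^ suc k) (2 ^ suc k)            ∎
  where open ≡-Reasoning

letterAt-suc : ∀ k {r d} → r < 2 ^ k → d < 2 ^ k → letterAt (suc k) r d ≡ letterAt k r d
letterAt-suc zero    {zero}  {zero}  _        _        = refl
letterAt-suc zero    {suc r} {d}     (s≤s ()) _
letterAt-suc zero    {zero}  {suc d} _        (s≤s ())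
letterAt-suc (suc k) {r}     {d}     r<       d<       =
  cong (λ x → child x (parity r) (parity d)) (letterAt-suc k (⌊/2⌋<2^ k r<) (⌊/2⌋<2^ k d<))

letterAt-stable : ∀ {k k′ r d} → k ≤ k′ → r < 2 ^ k → d < 2 ^ k → letterAt k′ r d ≡ letterAt k r d
letterAt-stable {k} k≤k′ = go (≤⇒≤′ k≤k′)
  where
  go : ∀ {k′ r d} → k ≤′ k′ → r < 2 ^ k → d < 2 ^ k → letterAt k′ r d ≡ letterAt k r d
  go ≤′-refl              r< d< = refl
  go (≤′-step {k′} k≤′k′) r< d< = trans (letterAt-suc k′ (grow r<) (grow d<)) (go k≤′k′ r< d<)
    where
    grow : ∀ {x} → x < 2 ^ k → x < 2 ^ k′
    grow x< = <-≤-trans x< (^-monoʳ-≤ 2 (≤′⇒≤ k≤′k′))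

τ : ℕ → ℕ → Letter
τ r d = letterAt (r + d) r d

letterAt≡τ : ∀ {k r d} → r < 2 ^ k → d < 2 ^ k → letterAt k r d ≡ τ r d
letterAt≡τ {k} {r} {d} r< d< =
  trans (sym (letterAt-stable (m≤m+n k (r + d)) r< d<))
        (letterAt-stable (m≤n+m (r + d) k) (<2^ (m≤m+n r d)) (<2^ (m≤n+m d r)))

τ-child : ∀ r d → τ r d ≡ child (τ ⌊ r /2⌋ ⌊ d /2⌋) (parity r) (parity d)
τ-child r d =
  trans (sym (letterAt≡τ {suc (r + d)} (<2^ (m≤n⇒m≤1+n (m≤m+n r d))) (<2^ (m≤n⇒m≤1+n (m≤n+m d r)))))
        (cong (λ x → child x (parity r) (parity d))
              (letterAt≡τ {r + d} (<2^ (≤-trans (⌊n/2⌋≤n r) (m≤m+n r d)))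
                                  (<2^ (≤-trans (⌊n/2⌋≤n d) (m≤n+m d r)))))

τ-+double : ∀ a b x y →
  τ (a + double x) (b + double y) ≡ child (τ (⌊ a /2⌋ + x) (⌊ b /2⌋ + y)) (parity a) (parity b)
τ-+double a b x y = trans (τ-child (a + double x) (b + double y))
  (cong₂ (λ (rd : ℕ × ℕ) (pq : Parity × Parity) → child (τ (proj₁ rd) (proj₂ rd)) (proj₁ pq) (proj₂ pq))
         (cong₂ _,_ (⌊+double/2⌋ a x) (⌊+double/2⌋ b y)) (cong₂ _,_ (parity-+double a x) (parity-+double b y)))

τ-bit+double : ∀ p q x y → τ (bit p + double x) (bit q + double y) ≡ child (τ x y) p q
τ-bit+double p q x y = trans (τ-+double (bit p) (bit q) x y) (small-offsets p q)
  where
  small-offsets : ∀ p q →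
    child (τ (⌊ bit p /2⌋ + x) (⌊ bit q /2⌋ + y)) (parity (bit p)) (parity (bit q)) ≡ child (τ x y) p q
  small-offsets 0ℙ 0ℙ = refl
  small-offsets 0ℙ 1ℙ = refl
  small-offsets 1ℙ 0ℙ = refl
  small-offsets 1ℙ 1ℙ = refl

window : ℕ → ℕ → ℕ → ℕ → Mat
window r d h w = grid (λ a b → τ (a + r) (b + d)) h w

μ-window : ∀ r d h w → μ (window r d h w) ≡ window (double r) (double d) (double h) (double w)
μ-window r d h w = trans (μ-grid _ h w) (grid-cong (double h) (double w) λ {a} {b} _ _ → sym (τ-+double a b r d))

sub-window : ∀ r₀ d₀ r c m n e₁ e₂ →
  sub (suc r) (suc c) m n (window r₀ d₀ (r + (m + e₁)) (c + (n + e₂))) ≡ window (r + r₀) (e₂ + d₀) m n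
sub-window r₀ d₀ r c m n e₁ e₂ = trans (sub-grid _ r c m n e₁ e₂)
  (grid-cong m n λ {a} {b} _ _ → cong₂ τ (xy∙z≈y∙xz r a r₀) (+-assoc b e₂ d₀))

drop-window : ∀ r d h w → drop 1 (window r d (suc h) w) ≡ window (suc r) d h w
drop-window r d h w = grid-cong h w λ {a} {b} _ _ → cong (λ x → τ x (b + d)) (sym (+-suc a r))

take-window : ∀ r d h w → map (take w) (window r d h (suc w)) ≡ grid (λ a b → τ (a + r) (suc b + d)) h w
take-window r d h w = trans (map-applyUpTo _ (take w) h) (applyUpTo-cong h λ a → take-applyDownFrom-suc _ w)

take-window-suc : ∀ r d h w → map (take w) (window r d h (suc w)) ≡ window r (suc d) h w
take-window-suc r d h w =
  trans (take-window r d h w) (grid-cong h w λ {a} {b} _ _ → cong (τ (a + r)) (sym (+-suc b d)))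

T≡window : ∀ k → T k ≡ window 0 0 (2 ^ k) (2 ^ k)
T≡window k = trans (T≡grid k) (grid-cong (2 ^ k) (2 ^ k) λ {a} {b} a< b< →
  trans (letterAt≡τ {k} a< b<) (sym (cong₂ τ (+-identityʳ a) (+-identityʳ b))))

sub-T : ∀ k r c m n e₁ e₂ → r + (m + e₁) ≡ 2 ^ k → c + (n + e₂) ≡ 2 ^ k →
        sub (suc r) (suc c) m n (T k) ≡ window r e₂ m n
sub-T k r c m n e₁ e₂ rows cols = begin
  sub (suc r) (suc c) m n (T k)
    ≡⟨ cong (sub (suc r) (suc c) m n) (T≡window k) ⟩
  sub (suc r) (suc c) m n (window 0 0 (2 ^ k) (2 ^ k))
    ≡⟨ cong₂ (λ h w → sub (suc r) (suc c) m n (window 0 0 h w)) (sym rows) (sym cols) ⟩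
  sub (suc r) (suc c) m n (window 0 0 (r + (m + e₁)) (c + (n + e₂)))
    ≡⟨ sub-window 0 0 r c m n e₁ e₂ ⟩
  window (r + 0) (e₂ + 0) m n
    ≡⟨ cong₂ (λ r d → window r d m n) (+-identityʳ r) (+-identityʳ e₂) ⟩
  window r e₂ m n
    ∎
  where open ≡-Reasoning

InPT⇒window : ∀ {m n x} → InPT m n x → ∃₂ λ r d → x ≡ window r d m n
InPT⇒window {m} {n} (k , suc r , suc c , _ , _ , rows≤ , cols≤ , refl) =
  let e₁ , rows = m≤n⇒∃[o]m+o≡n (≤-pred-+1 rows≤)
      e₂ , cols = m≤n⇒∃[o]m+o≡n (≤-pred-+1 cols≤)
  in r , e₂ , sub-T k r c m n e₁ e₂ (trans (sym (+-assoc r m e₁)) rows) (trans (sym (+-assoc c n e₂)) cols)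
  where
  ≤-pred-+1 : ∀ {x y} → suc x ≤ y + 1 → x ≤ y
  ≤-pred-+1 {x} {y} le = s≤s⁻¹ (subst (suc x ≤_) (+-comm y 1) le)

window∈PT : ∀ r d m n → InPT m n (window r d m n)
window∈PT r d m n =
  k , suc r , suc c , s≤s z≤n , s≤s z≤n , +1-mono rows≤ ,
  +1-mono (≤-trans (+-monoʳ-≤ c (m≤m+n n d)) (≤-reflexive cols)) ,
  sym (sub-T k r c m n (2 ^ k ∸ (r + m)) d rows cols)
  where
  k c : ℕ
  k = r + m + (n + d)
  c = 2 ^ k ∸ (n + d)
  rows≤ : r + m ≤ 2 ^ k
  rows≤ = <⇒≤ (<2^ (m≤m+n (r + m) (n + d)))
  cols≤ : n + d ≤ 2 ^ k
  cols≤ = <⇒≤ (<2^ (m≤n+m (n + d) (r + m)))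
  rows : r + (m + (2 ^ k ∸ (r + m))) ≡ 2 ^ k
  rows = trans (sym (+-assoc r m _)) (m+[n∸m]≡n rows≤)
  cols : c + (n + d) ≡ 2 ^ k
  cols = m∸n+n≡m cols≤
  +1-mono : ∀ {x y} → x ≤ y → suc x ≤ y + 1
  +1-mono {x} {y} le = subst (suc x ≤_) (+-comm 1 y) (s≤s le)

sub-μ-window : ∀ {i j m n} r d → i ≤ m → j ≤ n →
  sub (suc i) (suc j) m n (μ (window r d m n)) ≡ window (i + double r) ((n ∸ j) + double d) m n
sub-μ-window {i} {j} {m} {n} r d i≤m j≤n = begin
  sub (suc i) (suc j) m n (μ (window r d m n))
    ≡⟨ cong (sub (suc i) (suc j) m n) (μ-window r d m n) ⟩
  sub (suc i) (suc j) m n (window (double r) (double d) (double m) (double n))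
    ≡⟨ cong₂ (λ h w → sub (suc i) (suc j) m n (window (double r) (double d) h w))
             (double-split i≤m) (double-split j≤n) ⟩
  sub (suc i) (suc j) m n (window (double r) (double d) (i + (m + (m ∸ i))) (j + (n + (n ∸ j))))
    ≡⟨ sub-window (double r) (double d) i j m n (m ∸ i) (n ∸ j) ⟩
  window (i + double r) ((n ∸ j) + double d) m n
    ∎
  where open ≡-Reasoning

Pij⇒window : ∀ {i j m n y} → i ≤ m → j ≤ n → InPij (suc i) (suc j) m n y →
             ∃₂ λ r d → y ≡ window (i + double r) ((n ∸ j) + double d) m n
Pij⇒window i≤m j≤n (x , x∈PT , refl) with InPT⇒window x∈PT
... | r , d , refl = r , d , sub-μ-window r d i≤m j≤n

window∈Pij : ∀ {i j m n} r d → i ≤ m → j ≤ n →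
             InPij (suc i) (suc j) m n (window (i + double r) ((n ∸ j) + double d) m n)
window∈Pij {m = m} {n} r d i≤m j≤n = window r d m n , window∈PT r d m n , sym (sub-μ-window r d i≤m j≤n)

-- The 2×2 factors of τ

Quad : Set
Quad = Letter × Letter × Letter × Letter

_≟Q_ : DecidableEquality Quad
_≟Q_ = ×.≡-dec _≟_ (×.≡-dec _≟_ (×.≡-dec _≟_ _≟_))

open DecMembership _≟Q_ using (_∈?_)

≡-quad : ∀ {x x′ y y′ z z′ u u′ : Letter} → x ≡ x′ → y ≡ y′ → z ≡ z′ → u ≡ u′ →
         _≡_ {A = Quad} (x , y , z , u) (x′ , y′ , z′ , u′)
≡-quad refl refl refl refl = refl

Q : ℕ → ℕ → Quad
Q a b = τ a b , τ a (suc b) , τ (suc a) b , τ (suc a) (suc b)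

childQuad : Quad → Parity → Parity → Quad
childQuad (x , y , x′ , y′) 0ℙ 0ℙ = child x 0ℙ 0ℙ , child x 0ℙ 1ℙ , child x 1ℙ 0ℙ , child x 1ℙ 1ℙ
childQuad (x , y , x′ , y′) 0ℙ 1ℙ = child x 0ℙ 1ℙ , child y 0ℙ 0ℙ , child x 1ℙ 1ℙ , child y 1ℙ 0ℙ
childQuad (x , y , x′ , y′) 1ℙ 0ℙ = child x 1ℙ 0ℙ , child x 1ℙ 1ℙ , child x′ 0ℙ 0ℙ , child x′ 0ℙ 1ℙ
childQuad (x , y , x′ , y′) 1ℙ 1ℙ = child x 1ℙ 1ℙ , child y 1ℙ 0ℙ , child x′ 0ℙ 1ℙ , child y′ 0ℙ 0ℙ

Q-bit+double : ∀ p q a b → Q (bit p + double a) (bit q + double b) ≡ childQuad (Q a b) p q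
Q-bit+double 0ℙ 0ℙ a b = ≡-quad (τ-bit+double 0ℙ 0ℙ a b)       (τ-bit+double 0ℙ 1ℙ a b)
                                (τ-bit+double 1ℙ 0ℙ a b)       (τ-bit+double 1ℙ 1ℙ a b)
Q-bit+double 0ℙ 1ℙ a b = ≡-quad (τ-bit+double 0ℙ 1ℙ a b)       (τ-bit+double 0ℙ 0ℙ a (suc b))
                                (τ-bit+double 1ℙ 1ℙ a b)       (τ-bit+double 1ℙ 0ℙ a (suc b))
Q-bit+double 1ℙ 0ℙ a b = ≡-quad (τ-bit+double 1ℙ 0ℙ a b)       (τ-bit+double 1ℙ 1ℙ a b)
                                (τ-bit+double 0ℙ 0ℙ (suc a) b) (τ-bit+double 0ℙ 1ℙ (suc a) b)
Q-bit+double 1ℙ 1ℙ a b = ≡-quad (τ-bit+double 1ℙ 1ℙ a b)       (τ-bit+double 1ℙ 0ℙ a (suc b))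
                                (τ-bit+double 0ℙ 1ℙ (suc a) b) (τ-bit+double 0ℙ 0ℙ (suc a) (suc b))

Q-child : ∀ a b → Q a b ≡ childQuad (Q ⌊ a /2⌋ ⌊ b /2⌋) (parity a) (parity b)
Q-child a b = trans (sym (cong₂ Q (bit+double-⌊/2⌋ a) (bit+double-⌊/2⌋ b)))
                    (Q-bit+double (parity a) (parity b) ⌊ a /2⌋ ⌊ b /2⌋)

-- One position for each of the 76 distinct 2×2 factors of τ, all off the right edge.
quadPositions : List (ℕ × ℕ)
quadPositions =
  (0 , 1) ∷ (0 , 2) ∷ (1 , 1) ∷ (0 , 3) ∷ (1 , 2) ∷ (2 , 1) ∷ (0 , 4) ∷ (1 , 3) ∷ (2 , 2) ∷ (3 , 1) ∷
  (0 , 5) ∷ (1 , 4) ∷ (2 , 3) ∷ (3 , 2) ∷ (4 , 1) ∷ (1 , 5) ∷ (2 , 4) ∷ (3 , 3) ∷ (4 , 2) ∷ (5 , 1) ∷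
  (2 , 5) ∷ (3 , 4) ∷ (4 , 3) ∷ (5 , 2) ∷ (6 , 1) ∷ (0 , 8) ∷ (2 , 6) ∷ (3 , 5) ∷ (4 , 4) ∷ (5 , 3) ∷
  (7 , 1) ∷ (1 , 8) ∷ (2 , 7) ∷ (3 , 6) ∷ (4 , 5) ∷ (5 , 4) ∷ (6 , 3) ∷ (7 , 2) ∷ (0 , 10) ∷ (2 , 8) ∷
  (3 , 7) ∷ (5 , 5) ∷ (7 , 3) ∷ (0 , 11) ∷ (1 , 10) ∷ (3 , 8) ∷ (10 , 1) ∷ (1 , 11) ∷ (2 , 10) ∷ (4 , 8) ∷
  (10 , 2) ∷ (11 , 1) ∷ (2 , 11) ∷ (3 , 10) ∷ (5 , 8) ∷ (10 , 3) ∷ (11 , 2) ∷ (3 , 11) ∷ (4 , 10) ∷ (10 , 4) ∷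
  (11 , 3) ∷ (4 , 11) ∷ (5 , 10) ∷ (11 , 4) ∷ (5 , 11) ∷ (6 , 11) ∷ (7 , 10) ∷ (14 , 3) ∷ (15 , 2) ∷ (6 , 12) ∷
  (7 , 11) ∷ (15 , 3) ∷ (7 , 12) ∷ (22 , 3) ∷ (23 , 2) ∷ (23 , 3) ∷ []

quads : List Quad
quads = map (uncurry Q) quadPositions

quadPositions-off-edge : All (λ ab → 1 ≤ proj₂ ab) quadPositions
quadPositions-off-edge = from-yes (all? (λ ab → 1 ≤? proj₂ ab) quadPositions)

quads-closed : ∀ p q → All (λ X → childQuad X p q ∈ quads) quads
quads-closed 0ℙ 0ℙ = from-yes (all? (λ X → childQuad X 0ℙ 0ℙ ∈? quads) quads)
quads-closed 0ℙ 1ℙ = from-yes (all? (λ X → childQuad X 0ℙ 1ℙ ∈? quads) quads)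
quads-closed 1ℙ 0ℙ = from-yes (all? (λ X → childQuad X 1ℙ 0ℙ ∈? quads) quads)
quads-closed 1ℙ 1ℙ = from-yes (all? (λ X → childQuad X 1ℙ 1ℙ ∈? quads) quads)

Q∈quads : ∀ a b → Q a b ∈ quads
Q∈quads a b = go (a + b) (<2^ (m≤m+n a b)) (<2^ (m≤n+m b a))
  where
  go : ∀ k {a b} → a < 2 ^ k → b < 2 ^ k → Q a b ∈ quads
  go zero    {zero}  {zero}  _        _        = from-yes (Q 0 0 ∈? quads)
  go zero    {suc a} {b}     (s≤s ()) _
  go zero    {zero}  {suc b} _        (s≤s ())
  go (suc k) {a}     {b}     a<       b<       = subst (_∈ quads) (sym (Q-child a b))
    (All.lookup (quads-closed (parity a) (parity b)) (go k (⌊/2⌋<2^ k a<) (⌊/2⌋<2^ k b<)))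

quad-determines-τ : ∀ l {a b a′ b′ s t} → Q a b ≡ Q a′ b′ → s < 2 ^ suc l → t < 2 ^ suc l →
                    τ (s + double^ l a) (t + double^ l b) ≡ τ (s + double^ l a′) (t + double^ l b′)
quad-determines-τ zero {s = 0}           {0}           eq _                _ = cong proj₁ eq
quad-determines-τ zero {s = 0}           {1}           eq _                _ = cong (proj₁ ∘ proj₂) eq
quad-determines-τ zero {s = 1}           {0}           eq _                _ = cong (proj₁ ∘ proj₂ ∘ proj₂) eq
quad-determines-τ zero {s = 1}           {1}           eq _                _ = cong (proj₂ ∘ proj₂ ∘ proj₂) eq
quad-determines-τ zero {s = suc (suc _)}               eq (s≤s (s≤s ())) _
quad-determines-τ zero {s = 0}           {suc (suc _)} eq _ (s≤s (s≤s ()))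
quad-determines-τ zero {s = 1}           {suc (suc _)} eq _ (s≤s (s≤s ()))
quad-determines-τ (suc l) {a} {b} {a′} {b′} {s} {t} eq s< t< = begin
  τ (s + double (double^ l a)) (t + double (double^ l b))
    ≡⟨ τ-+double s t (double^ l a) (double^ l b) ⟩
  child (τ (⌊ s /2⌋ + double^ l a) (⌊ t /2⌋ + double^ l b)) (parity s) (parity t)
    ≡⟨ cong (λ x → child x (parity s) (parity t))
            (quad-determines-τ l eq (⌊/2⌋<2^ (suc l) s<) (⌊/2⌋<2^ (suc l) t<)) ⟩
  child (τ (⌊ s /2⌋ + double^ l a′) (⌊ t /2⌋ + double^ l b′)) (parity s) (parity t)
    ≡⟨ sym (τ-+double s t (double^ l a′) (double^ l b′)) ⟩
  τ (s + double (double^ l a′)) (t + double (double^ l b′))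
    ∎
  where open ≡-Reasoning

quad-determines-window : ∀ l {a b a′ b′ s t h w} → Q a b ≡ Q a′ b′ →
  s < 2 ^ l → t < 2 ^ l → h ≤ 2 ^ l → w ≤ 2 ^ l →
  window (s + double^ l a) (t + double^ l b) h w ≡ window (s + double^ l a′) (t + double^ l b′) h w
quad-determines-window l {a} {b} {a′} {b′} {s} {t} {h} {w} eq s< t< h≤ w≤ =
  grid-cong h w λ {x} {y} x< y< → begin
  τ (x + (s + double^ l a)) (y + (t + double^ l b))     ≡⟨ cong₂ τ (sym (+-assoc x s _)) (sym (+-assoc y t _)) ⟩
  τ (x + s + double^ l a) (y + t + double^ l b)         ≡⟨ quad-determines-τ l eq (sum< x< h≤ s<) (sum< y< w≤ t<) ⟩
  τ (x + s + double^ l a′) (y + t + double^ l b′)       ≡⟨ cong₂ τ (+-assoc x s _) (+-assoc y t _) ⟩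
  τ (x + (s + double^ l a′)) (y + (t + double^ l b′))   ∎
  where
  open ≡-Reasoning
  sum< : ∀ {x n s} → x < n → n ≤ 2 ^ l → s < 2 ^ l → x + s < 2 ^ suc l
  sum< x< n≤ s< =
    <-≤-trans (+-mono-< (<-≤-trans x< n≤) s<) (≤-reflexive (cong (2 ^ l +_) (sym (+-identityʳ _))))

place : ℕ → ℕ × ℕ → ℕ × ℕ → ℕ × ℕ
place l (a , b) (s , t) = s + double^ l a , t + double^ l b

candidates : ℕ → List (ℕ × ℕ)
candidates l = cartesianProductWith (place l) quadPositions (cartesianProduct (upTo (2 ^ l)) (upTo (2 ^ l)))

-- A window of size at most 2^(l+1) lies inside a 2×2 arrangement of blocks of size 2^(l+1),
-- which is the image under μ^(l+1) of a 2×2 factor of τ.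
window-at-candidate : ∀ l {h w} → h ≤ 2 ^ suc l → w ≤ 2 ^ suc l → ∀ r d → ∃₂ λ r′ d′ →
  (r′ , d′) ∈ candidates (suc l) × 2 ^ suc l ≤ d′ × parity r′ ≡ parity r × parity d′ ≡ parity d ×
  window r d h w ≡ window r′ d′ h w
window-at-candidate l {h} {w} h≤ w≤ r d with divMod-2^ (suc l) r | divMod-2^ (suc l) d
... | s , a , s< , r≡ | t , b , t< , d≡ with ∈-map⁻ (uncurry Q) {xs = quadPositions} (Q∈quads a b)
... | (a′ , b′) , ab′∈ , Qab≡ =
  s + double^ (suc l) a′ , t + double^ (suc l) b′ ,
  ∈-cartesianProductWith⁺ (place (suc l)) ab′∈ (∈-cartesianProduct⁺ (∈-upTo⁺ s<) (∈-upTo⁺ t<)) ,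
  ≤-trans off-edge (m≤n+m _ t) ,
  trans (parity-+double s _) (sym (trans (cong parity r≡) (parity-+double s _))) ,
  trans (parity-+double t _) (sym (trans (cong parity d≡) (parity-+double t _))) ,
  trans (cong₂ (λ r d → window r d h w) r≡ d≡) (quad-determines-window (suc l) Qab≡ s< t< h≤ w≤)
  where
  off-edge : 2 ^ suc l ≤ double^ (suc l) b′
  off-edge = ≤-trans (≤-reflexive (sym (+-identityʳ _)))
    (≤-trans (*-monoˡ-≤ (2 ^ suc l) (All.lookup quadPositions-off-edge ab′∈))
             (≤-reflexive (sym (double^≡*2^ (suc l) b′))))

-- For X = Q a b, child x p q is the letter of τ at (2a + p, 2b + q); x′ is the letter below x
-- in TopDetermined and the letter to the left of x in RightDetermined.
TopDetermined : Parity → Quad → Quad → Set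
TopDetermined q (x , _ , x′ , _) (y , _ , y′ , _) =
  child x 1ℙ q ≡ child y 1ℙ q → child x′ 0ℙ q ≡ child y′ 0ℙ q → child x 0ℙ q ≡ child y 0ℙ q

topDetermined? : ∀ q X Y → Dec (TopDetermined q X Y)
topDetermined? q (x , _ , x′ , _) (y , _ , y′ , _) = (_ ≟ _) →-dec ((_ ≟ _) →-dec (_ ≟ _))

top-determined : ∀ q → All (λ X → All (TopDetermined q X) quads) quads
top-determined 0ℙ = from-yes (all? (λ X → all? (topDetermined? 0ℙ X) quads) quads)
top-determined 1ℙ = from-yes (all? (λ X → all? (topDetermined? 1ℙ X) quads) quads)

RightDetermined : Parity → Quad → Quad → Set
RightDetermined p (x , x′ , _ , _) (y , y′ , _ , _) =
  child x p 1ℙ ≡ child y p 1ℙ → child x′ p 0ℙ ≡ child y′ p 0ℙ → child x p 0ℙ ≡ child y p 0ℙ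

rightDetermined? : ∀ p X Y → Dec (RightDetermined p X Y)
rightDetermined? p (x , x′ , _ , _) (y , y′ , _ , _) = (_ ≟ _) →-dec ((_ ≟ _) →-dec (_ ≟ _))

right-determined : ∀ p → All (λ X → All (RightDetermined p X) quads) quads
right-determined 0ℙ = from-yes (all? (λ X → all? (rightDetermined? 0ℙ X) quads) quads)
right-determined 1ℙ = from-yes (all? (λ X → all? (rightDetermined? 1ℙ X) quads) quads)

τ-top-determined : ∀ {q} r r′ d d′ → parity r ≡ 0ℙ → parity r′ ≡ 0ℙ → parity d ≡ q → parity d′ ≡ q →
  τ (1 + r) d ≡ τ (1 + r′) d′ → τ (2 + r) d ≡ τ (2 + r′) d′ → τ r d ≡ τ r′ d′
τ-top-determined {q} r r′ d d′ r-even r′-even d~q d′~q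
  with parity-split r r-even | parity-split r′ r′-even | parity-split d d~q | parity-split d′ d′~q
... | a , refl | a′ , refl | b , refl | b′ , refl = λ below below² → begin
  τ (double a) (bit q + double b)      ≡⟨ τ-bit+double 0ℙ q a b ⟩
  child (τ a b) 0ℙ q                   ≡⟨ rule (lift 1ℙ a a′ below) (lift 0ℙ (suc a) (suc a′) below²) ⟩
  child (τ a′ b′) 0ℙ q                 ≡⟨ sym (τ-bit+double 0ℙ q a′ b′) ⟩
  τ (double a′) (bit q + double b′)    ∎
  where
  open ≡-Reasoning
  rule : TopDetermined q (Q a b) (Q a′ b′)
  rule = All.lookup (All.lookup (top-determined q) (Q∈quads a b)) (Q∈quads a′ b′)
  lift : ∀ p x x′ → τ (bit p + double x) (bit q + double b) ≡ τ (bit p + double x′) (bit q + double b′) →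
         child (τ x b) p q ≡ child (τ x′ b′) p q
  lift p x x′ eq = trans (sym (τ-bit+double p q x b)) (trans eq (τ-bit+double p q x′ b′))

τ-right-determined : ∀ {p} r r′ d d′ → parity d ≡ 0ℙ → parity d′ ≡ 0ℙ → parity r ≡ p → parity r′ ≡ p →
  τ r (1 + d) ≡ τ r′ (1 + d′) → τ r (2 + d) ≡ τ r′ (2 + d′) → τ r d ≡ τ r′ d′
τ-right-determined {p} r r′ d d′ d-even d′-even r~p r′~p
  with parity-split d d-even | parity-split d′ d′-even | parity-split r r~p | parity-split r′ r′~p
... | b , refl | b′ , refl | a , refl | a′ , refl = λ left left² → begin
  τ (bit p + double a) (double b)      ≡⟨ τ-bit+double p 0ℙ a b ⟩
  child (τ a b) p 0ℙ                   ≡⟨ rule (lift 1ℙ b b′ left) (lift 0ℙ (suc b) (suc b′) left²) ⟩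
  child (τ a′ b′) p 0ℙ                 ≡⟨ sym (τ-bit+double p 0ℙ a′ b′) ⟩
  τ (bit p + double a′) (double b′)    ∎
  where
  open ≡-Reasoning
  rule : RightDetermined p (Q a b) (Q a′ b′)
  rule = All.lookup (All.lookup (right-determined p) (Q∈quads a b)) (Q∈quads a′ b′)
  lift : ∀ q y y′ → τ (bit p + double a) (bit q + double y) ≡ τ (bit p + double a′) (bit q + double y′) →
         child (τ a y) p q ≡ child (τ a′ y′) p q
  lift q y y′ eq = trans (sym (τ-bit+double p q a y)) (trans eq (τ-bit+double p q a′ y′))

-- Parity classes of windows

Windows : Parity → Parity → ℕ → ℕ → Mat → Set
Windows p q h w y = ∃₂ λ r d → parity r ≡ p × parity d ≡ q × y ≡ window r d h w

hasParities? : ∀ p q → Decidable (λ (rd : ℕ × ℕ) → parity (proj₁ rd) ≡ p × parity (proj₂ rd) ≡ q)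
hasParities? p q (r , d) = (parity r ≟ₚ p) ×-dec (parity d ≟ₚ q)

windowAt : ℕ → ℕ → ℕ × ℕ → Mat
windowAt h w (r , d) = window r d h w

candidatePositions : Parity → Parity → ℕ → ℕ → List (ℕ × ℕ)
candidatePositions p q h w = filter (hasParities? p q) (candidates (suc (h + w)))

Windows⇔∈candidates : ∀ p q h w y → Windows p q h w y ⇔ y ∈ map (windowAt h w) (candidatePositions p q h w)
Windows⇔∈candidates p q h w y = mk⇔ to from
  where
  to : Windows p q h w y → y ∈ map (windowAt h w) (candidatePositions p q h w)
  to (r , d , r~p , d~q , refl) =
    let r′ , d′ , ∈candidates , _ , r′~r , d′~d , same =
          window-at-candidate (h + w) (height≤2^ h w) (width≤2^ h w) r d
    in subst (_∈ map (windowAt h w) (candidatePositions p q h w)) (sym same)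
         (∈-map⁺ (windowAt h w) (∈-filter⁺ (hasParities? p q) ∈candidates (trans r′~r r~p , trans d′~d d~q)))
  from : y ∈ map (windowAt h w) (candidatePositions p q h w) → Windows p q h w y
  from y∈ =
    let (r , d) , ∈positions , y≡ = ∈-map⁻ (windowAt h w) {xs = candidatePositions p q h w} y∈
        _ , r~p , d~q = ∈-filter⁻ (hasParities? p q) {xs = candidates (suc (h + w))} ∈positions
    in r , d , r~p , d~q , y≡

Windows-finite : ∀ p q h w → ∃ (HasCard (Windows p q h w))
Windows-finite p q h w =
  _ , HasCard-cover (map (windowAt h w) (candidatePositions p q h w)) (Windows⇔∈candidates p q h w)

drop-top-bijective : ∀ q h w → 2 ≤ h → Bijective (drop 1) (Windows 0ℙ q (suc h) w) (Windows 1ℙ q h w)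
drop-top-bijective q h w 2≤h = record { maps-to = maps-to ; injective = injective ; surjective = surjective }
  where
  maps-to : ∀ {x} → Windows 0ℙ q (suc h) w x → Windows 1ℙ q h w (drop 1 x)
  maps-to (r , d , r-even , d~q , refl) =
    suc r , d , trans (parity-suc r) (cong _⁻¹ r-even) , d~q , drop-window r d h w

  injective : ∀ {x y} → Windows 0ℙ q (suc h) w x → Windows 0ℙ q (suc h) w y → drop 1 x ≡ drop 1 y → x ≡ y
  injective (r₁ , d₁ , r₁-even , d₁~q , refl) (r₂ , d₂ , r₂-even , d₂~q , refl) eq = grid-cong (suc h) w cell
    where
    below : ∀ {a b} → a < h → b < w → τ (suc a + r₁) (b + d₁) ≡ τ (suc a + r₂) (b + d₂)
    below = grid-injective h w eq
    cell : ∀ {a b} → a < suc h → b < w → τ (a + r₁) (b + d₁) ≡ τ (a + r₂) (b + d₂)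
    cell {zero}  {b} _         b< = τ-top-determined r₁ r₂ (b + d₁) (b + d₂) r₁-even r₂-even
                                      (parity-+ b d₁ d₁~q) (parity-+ b d₂ d₂~q)
                                      (below (≤-trans (s≤s z≤n) 2≤h) b<) (below 2≤h b<)
    cell {suc a}     (s≤s a<h) b< = below a<h b<

  surjective : ∀ {y} → Windows 1ℙ q h w y → ∃ λ x → Windows 0ℙ q (suc h) w x × drop 1 x ≡ y
  surjective (r , d , r-odd , d~q , refl) with odd⇒suc r r-odd
  ... | r′ , refl , r′-even = window r′ d (suc h) w , (r′ , d , r′-even , d~q , refl) , drop-window r′ d h w

drop-right-bijective : ∀ p h w → 2 ≤ w → Bijective (map (take w)) (Windows p 0ℙ h (suc w)) (Windows p 1ℙ h w)
drop-right-bijective p h w 2≤w = record { maps-to = maps-to ; injective = injective ; surjective = surjective }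
  where
  maps-to : ∀ {x} → Windows p 0ℙ h (suc w) x → Windows p 1ℙ h w (map (take w) x)
  maps-to (r , d , r~p , d-even , refl) =
    r , suc d , r~p , trans (parity-suc d) (cong _⁻¹ d-even) , take-window-suc r d h w

  injective : ∀ {x y} → Windows p 0ℙ h (suc w) x → Windows p 0ℙ h (suc w) y →
              map (take w) x ≡ map (take w) y → x ≡ y
  injective (r₁ , d₁ , r₁~p , d₁-even , refl) (r₂ , d₂ , r₂~p , d₂-even , refl) eq = grid-cong h (suc w) cell
    where
    left : ∀ {a b} → a < h → b < w → τ (a + r₁) (suc b + d₁) ≡ τ (a + r₂) (suc b + d₂)
    left = grid-injective h w (trans (sym (take-window r₁ d₁ h w)) (trans eq (take-window r₂ d₂ h w)))
    cell : ∀ {a b} → a < h → b < suc w → τ (a + r₁) (b + d₁) ≡ τ (a + r₂) (b + d₂)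
    cell {a} {zero}  a< _         = τ-right-determined (a + r₁) (a + r₂) d₁ d₂ d₁-even d₂-even
                                      (parity-+ a r₁ r₁~p) (parity-+ a r₂ r₂~p)
                                      (left a< (≤-trans (s≤s z≤n) 2≤w)) (left a< 2≤w)
    cell {a} {suc b} a< (s≤s b<w) = left a< b<w

  surjective : ∀ {y} → Windows p 1ℙ h w y → ∃ λ x → Windows p 0ℙ h (suc w) x × map (take w) x ≡ y
  surjective (r , d , r~p , d-odd , refl) with odd⇒suc d d-odd
  ... | d′ , refl , d′-even = window r d′ h (suc w) , (r , d′ , r~p , d′-even , refl) , take-window-suc r d′ h w

Windows-normal-right : ∀ q {h w} → 2 ≤ w → SameCard (Windows 0ℙ q h w) (Windows 0ℙ 0ℙ h (bit q + w))
Windows-normal-right 0ℙ {h} {w} _   = SameCard-refl (Windows-finite 0ℙ 0ℙ h w)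
Windows-normal-right 1ℙ {h} {w} 2≤w =
  SameCard-sym (Bijective⇒SameCard (drop-right-bijective 0ℙ h w 2≤w) (Windows-finite 0ℙ 0ℙ h (suc w)))

Windows-normal : ∀ p q {h w} → 2 ≤ h → 2 ≤ w → SameCard (Windows p q h w) (Windows 0ℙ 0ℙ (bit p + h) (bit q + w))
Windows-normal 0ℙ q         _   2≤w = Windows-normal-right q 2≤w
Windows-normal 1ℙ q {h} {w} 2≤h 2≤w = SameCard-trans
  (SameCard-sym (Bijective⇒SameCard (drop-top-bijective q h w 2≤h) (Windows-finite 0ℙ q (suc h) w)))
  (Windows-normal-right q 2≤w)

-- The inclusion ⊇ moves the window away from the right edge of τ (window-at-candidate), so that
-- it lies inside the μ-image of a window.
Pij⇔Windows : ∀ {i j m n} → i ≤ 1 → i ≤ m → j ≤ n →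
              ∀ y → InPij (suc i) (suc j) m n y ⇔ Windows (parity i) (parity (n ∸ j)) m n y
Pij⇔Windows {i} {j} {m} {n} i≤1 i≤m j≤n y = mk⇔ to from
  where
  to : InPij (suc i) (suc j) m n y → Windows (parity i) (parity (n ∸ j)) m n y
  to y∈ with Pij⇒window i≤m j≤n y∈
  ... | r , d , refl = i + double r , (n ∸ j) + double d , parity-+double i r , parity-+double (n ∸ j) d , refl

  from : Windows (parity i) (parity (n ∸ j)) m n y → InPij (suc i) (suc j) m n y
  from (r , d , r~i , d~n∸j , refl) =
    let r′ , d′ , _ , off-edge , r′~r , d′~d , same =
          window-at-candidate (m + n) (height≤2^ m n) (width≤2^ m n) r d
        a , r′≡ = same-parity-split r′ (≤-by-parity r′ i≤1 (trans r′~r r~i)) (trans r′~r r~i)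
        b , d′≡ = same-parity-split d′ (≤-trans (m∸n≤m n j) (≤-trans (width≤2^ m n) off-edge))
                                       (trans d′~d d~n∸j)
    in subst (InPij (suc i) (suc j) m n) (sym (trans same (cong₂ (λ r d → window r d m n) r′≡ d′≡)))
             (window∈Pij a b i≤m j≤n)

Pij-normal : ∀ {i j m n} → i ≤ 1 → j ≤ 1 → 2 ≤ m → 2 ≤ n →
  SameCard (InPij (suc i) (suc j) m n) (Windows 0ℙ 0ℙ (bit (parity i) + m) (bit (parity (n ∸ j)) + n))
Pij-normal i≤1 j≤1 2≤m 2≤n =
  SameCard-resp-⇔
    (Pij⇔Windows i≤1 (≤-trans i≤1 (≤-trans (s≤s z≤n) 2≤m)) (≤-trans j≤1 (≤-trans (s≤s z≤n) 2≤n)))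
    (Windows-normal _ _ 2≤m 2≤n)

-- m ⊕ k is m + k, except that m ⊕ 0 is m itself: both 4 * n and 4 * n + k in the
-- statement are then instances of 4 * n ⊕ k.
_⊕_ : ℕ → ℕ → ℕ
m ⊕ zero  = m
m ⊕ suc k = m + suc k

⊕≡+ : ∀ m k → m ⊕ k ≡ m + k
⊕≡+ m zero    = sym (+-identityʳ m)
⊕≡+ m (suc k) = refl

data Corner : ℕ → Set where
  instance
    first  : Corner 1
    second : Corner 2

corner≤1 : ∀ {i} → Corner (suc i) → i ≤ 1
corner≤1 first  = z≤n
corner≤1 second = s≤s z≤n

bit-parity : ∀ {i} → i ≤ 1 → bit (parity i) ≡ i
bit-parity z≤n       = refl
bit-parity (s≤s z≤n) = refl

parity-∸ : ∀ {j} x → j ≤ x → parity (x ∸ j) ≡ parity (x + j)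
parity-∸ x       z≤n       = cong parity (sym (+-identityʳ x))
parity-∸ (suc x) (s≤s j≤x) = trans (parity-∸ x j≤x) (cong (parity ∘ suc) (sym (+-suc x _)))

module Shapes (m₀ : ℕ) (m₀-even : parity m₀ ≡ 0ℙ) (2≤m₀ : 2 ≤ m₀) where

  -- As m₀ is even, the column parity n − j + 1 at width n = m₀ + k is that of pred j + k.
  HasShape : (Mat → Set) → ℕ → ℕ → Set
  HasShape S h w = SameCard S (Windows 0ℙ 0ℙ (m₀ + h) (m₀ + w))

  same : ∀ {S S′ h w} → HasShape S h w → HasShape S′ h w → SameCard S S′
  same S~ S′~ = SameCard-trans S~ (SameCard-sym S′~)

  Pij-shape : ∀ i j {{_ : Corner i}} {{_ : Corner j}} {m n} r s → m ≡ m₀ + r → n ≡ m₀ + s →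
              HasShape (InPij i j m n) (pred i + r) (bit (parity (pred j + s)) + s)
  Pij-shape (suc i) (suc j) {{i-corner}} {{j-corner}} r s refl refl =
    subst₂ (λ h w → SameCard (InPij (suc i) (suc j) (m₀ + r) (m₀ + s)) (Windows 0ℙ 0ℙ h w)) rows cols
      (Pij-normal (corner≤1 i-corner) (corner≤1 j-corner)
                  (≤-trans 2≤m₀ (m≤m+n m₀ r)) (≤-trans 2≤m₀ (m≤m+n m₀ s)))
    where
    j≤m₀+s : j ≤ m₀ + s
    j≤m₀+s = ≤-trans (corner≤1 j-corner) (≤-trans (s≤s z≤n) (≤-trans 2≤m₀ (m≤m+n m₀ s)))
    parity≡ : parity (m₀ + s ∸ j) ≡ parity (j + s)
    parity≡ = begin
      parity (m₀ + s ∸ j)           ≡⟨ parity-∸ (m₀ + s) j≤m₀+s ⟩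
      parity (m₀ + s + j)           ≡⟨ cong parity (+-assoc m₀ s j) ⟩
      parity (m₀ + (s + j))         ≡⟨ +-homo-+ m₀ (s + j) ⟩
      parity m₀ ℙ.+ parity (s + j)  ≡⟨ cong (ℙ._+ parity (s + j)) m₀-even ⟩
      parity (s + j)                ≡⟨ cong parity (+-comm s j) ⟩
      parity (j + s)                ∎
      where open ≡-Reasoning
    rows : bit (parity i) + (m₀ + r) ≡ m₀ + (i + r)
    rows = trans (cong (_+ (m₀ + r)) (bit-parity (corner≤1 i-corner))) (x∙yz≈y∙xz i m₀ r)
    cols : bit (parity (m₀ + s ∸ j)) + (m₀ + s) ≡ m₀ + (bit (parity (j + s)) + s)
    cols = trans (cong (λ p → bit p + (m₀ + s)) parity≡) (x∙yz≈y∙xz _ m₀ s)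

  a : ∀ i j {{_ : Corner i}} {{_ : Corner j}} k →
      HasShape (Aset i j (m₀ ⊕ k)) (pred i + k) (bit (parity (pred j + k)) + k)
  a i j k = Pij-shape i j k k (⊕≡+ m₀ k) (⊕≡+ m₀ k)

  b : ∀ i j {{_ : Corner i}} {{_ : Corner j}} k →
      HasShape (Bset i j (m₀ ⊕ k)) (pred i + k) (bit (parity (pred j + suc k)) + suc k)
  b i j k = Pij-shape i j k (suc k) (⊕≡+ m₀ k) (trans (cong suc (⊕≡+ m₀ k)) (sym (+-suc m₀ k)))

  c : ∀ i j {{_ : Corner i}} {{_ : Corner j}} k →
      HasShape (Cset i j (m₀ ⊕ k)) (pred i + suc k) (bit (parity (pred j + k)) + k)
  c i j k = Pij-shape i j (suc k) k (trans (cong suc (⊕≡+ m₀ k)) (sym (+-suc m₀ k))) (⊕≡+ m₀ k)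

corollary1 : (n : ℕ) → 1 ≤ n →
      SameCard (Aset 1 2 (4 * n)) (Bset 1 2 (4 * n))
    × SameCard (Aset 2 1 (4 * n)) (Cset 1 1 (4 * n))
    × (SameCard (Aset 2 2 (4 * n)) (Aset 1 2 (4 * n + 1)) × SameCard (Aset 1 2 (4 * n + 1)) (Cset 1 2 (4 * n)) × SameCard (Cset 1 2 (4 * n)) (Bset 2 2 (4 * n)))
    × (SameCard (Aset 1 1 (4 * n + 1)) (Bset 1 1 (4 * n + 1)) × SameCard (Bset 1 1 (4 * n + 1)) (Bset 2 1 (4 * n)))
    × (SameCard (Aset 2 1 (4 * n + 1)) (Aset 1 1 (4 * n + 2)) × SameCard (Aset 1 1 (4 * n + 2)) (Cset 1 1 (4 * n + 1)) × SameCard (Cset 1 1 (4 * n + 1)) (Bset 2 1 (4 * n + 1)))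
    × (SameCard (Aset 2 2 (4 * n + 1)) (Cset 1 2 (4 * n + 1)) × SameCard (Cset 1 2 (4 * n + 1)) (Cset 2 2 (4 * n)))
    × (SameCard (Aset 1 2 (4 * n + 2)) (Bset 1 2 (4 * n + 2)) × SameCard (Bset 1 2 (4 * n + 2)) (Bset 2 2 (4 * n + 1)))
    × (SameCard (Aset 2 1 (4 * n + 2)) (Cset 1 1 (4 * n + 2)) × SameCard (Cset 1 1 (4 * n + 2)) (Cset 2 1 (4 * n + 1)))
    × (SameCard (Aset 2 2 (4 * n + 2)) (Aset 1 2 (4 * n + 3)) × SameCard (Aset 1 2 (4 * n + 3)) (Cset 1 2 (4 * n + 2)) × SameCard (Cset 1 2 (4 * n + 2)) (Bset 2 2 (4 * n + 2)))
    × (SameCard (Aset 1 1 (4 * n + 3)) (Bset 1 1 (4 * n + 3)) × SameCard (Bset 1 1 (4 * n + 3)) (Bset 2 1 (4 * n + 2)))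
    × (SameCard (Aset 2 1 (4 * n + 3)) (Cset 1 1 (4 * n + 3)) × SameCard (Cset 1 1 (4 * n + 3)) (Bset 2 1 (4 * n + 3)))
    × (SameCard (Aset 2 2 (4 * n + 3)) (Cset 1 2 (4 * n + 3)) × SameCard (Cset 1 2 (4 * n + 3)) (Cset 2 2 (4 * n + 2)))
corollary1 n 1≤n =
    same (a 1 2 0) (b 1 2 0)
  , same (a 2 1 0) (c 1 1 0)
  , (same (a 2 2 0) (a 1 2 1) , same (a 1 2 1) (c 1 2 0) , same (c 1 2 0) (b 2 2 0))
  , (same (a 1 1 1) (b 1 1 1) , same (b 1 1 1) (b 2 1 0))
  , (same (a 2 1 1) (a 1 1 2) , same (a 1 1 2) (c 1 1 1) , same (c 1 1 1) (b 2 1 1))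
  , (same (a 2 2 1) (c 1 2 1) , same (c 1 2 1) (c 2 2 0))
  , (same (a 1 2 2) (b 1 2 2) , same (b 1 2 2) (b 2 2 1))
  , (same (a 2 1 2) (c 1 1 2) , same (c 1 1 2) (c 2 1 1))
  , (same (a 2 2 2) (a 1 2 3) , same (a 1 2 3) (c 1 2 2) , same (c 1 2 2) (b 2 2 2))
  , (same (a 1 1 3) (b 1 1 3) , same (b 1 1 3) (b 2 1 2))
  , (same (a 2 1 3) (c 1 1 3) , same (c 1 1 3) (b 2 1 3))
  , (same (a 2 2 3) (c 1 2 3) , same (c 1 2 3) (c 2 2 2))
  where open Shapes (4 * n) (*-homo-* 4 n) (≤-trans (s≤s (s≤s z≤n)) (*-monoʳ-≤ 4 1≤n))
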